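{- Let $p$ be a prime and $c$ an integer. Then, as polynomials in $x$ modulo $p$, $$\prod_{i=1}^{p-1}(ix-i+c)\equiv\begin{cases}-(x-1)^{p-1} & \text{if } p\mid c,\\ -(x+x^2+\dots+x^{p-1})=\dfrac{x^p-x}{1-x} & \text{otherwise.}\end{cases}$$ -}

module Defs where

open import Data.Nat using (ℕ; zero; suc; _∸_)
open import Data.Integer using (ℤ; +_; -_) renaming (_+_ to _+ℤ_; _*_ to _*ℤ_; _-_ to _-ℤ_)
open import Data.Integer.Divisibility using (_∣_)
open import Data.List using (List; []; _∷_; map; foldr; applyUpTo)

-- Polynomials in one variable x with integer coefficients,
-- represented as coefficient lists, lowest degree first:
-- a₀ ∷ a₁ ∷ … ∷ aₙ ∷ []  represents  a₀ + a₁ x + … + aₙ xⁿ.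
Poly : Set
Poly = List ℤ

coeff : Poly → ℕ → ℤ
coeff []       _       = + 0
coeff (a ∷ f)  zero    = a
coeff (a ∷ f)  (suc k) = coeff f k

infixl 6 _+P_
infixl 7 _*P_ _·P_

_+P_ : Poly → Poly → Poly
[]      +P g       = g
(a ∷ f) +P []      = a ∷ f
(a ∷ f) +P (b ∷ g) = (a +ℤ b) ∷ (f +P g)

_·P_ : ℤ → Poly → Poly
a ·P f = map (a *ℤ_) f

negP : Poly → Poly
negP f = (- + 1) ·P f

_*P_ : Poly → Poly → Poly
[]      *P g = []
(a ∷ f) *P g = (a ·P g) +P (+ 0 ∷ (f *P g))

constP : ℤ → Poly
constP a = a ∷ []

oneP : Poly
oneP = constP (+ 1)

X : Poly
X = + 0 ∷ + 1 ∷ []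

_^P_ : Poly → ℕ → Poly
f ^P zero  = oneP
f ^P suc n = f *P (f ^P n)

prodP : List Poly → Poly
prodP = foldr _*P_ oneP

sumP : List Poly → Poly
sumP = foldr _+P_ []

_≡P_[mod_] : Poly → Poly → ℤ → Set
f ≡P g [mod m ] = ∀ k → m ∣ (coeff f k -ℤ coeff g k)

oneTo : ℕ → List ℕ
oneTo n = applyUpTo suc n

factor : ℤ → ℕ → Poly
factor c i = ((c -ℤ + i) ∷ + i ∷ [])

lhs : ℕ → ℤ → Poly
lhs p c = prodP (map (factor c) (oneTo (p ∸ 1)))

rhsDiv : ℕ → Poly
rhsDiv p = negP ((X +P constP (- + 1)) ^P (p ∸ 1))

rhsNotDiv : ℕ → Poly
rhsNotDiv p = negP (sumP (map (X ^P_) (oneTo (p ∸ 1))))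

{-# OPTIONS --safe #-}
module Submission where

-- Both sides have degree at most p - 1, and over the field ℤ/p a polynomial of degree
-- below p with p roots vanishes, so it suffices to compare the two sides at the residues
-- x = 0, 1, …, p - 1.  If p ∣ c the left side is (p - 1)! (x - 1)^(p-1), and Wilson's
-- theorem (p - 1)! ≡ -1 finishes.  If p ∤ c: at x = 1 the left side is c^(p-1) ≡ 1 and the
-- right side is -(p - 1) ≡ 1; at any other residue the factor with i ≡ -c/(x - 1) kills the
-- left side, while (x - 1)(x + ⋯ + x^(p-1)) = x^p - x ≡ 0 kills the right side.

open import Defs

open import Data.Nat as ℕ using (ℕ; zero; suc; _∸_; _<_; _≤_; z≤n; s≤s)
import Data.Nat.Properties as ℕP
import Data.Nat.Divisibility as ℕDiv
import Data.Nat.DivMod as ℕDivMod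
open import Data.Nat.Primality using (Prime; euclidsLemma; prime⇒nonTrivial)
open import Data.Nat.Combinatorics using (_C_; nCn≡1; nCk≡n!/k![n-k]!; k![n∸k]!∣n!)
open import Data.Integer
  using (ℤ; +_; -[1+_]; +[1+_]; 0ℤ; 1ℤ; -1ℤ; -_; _+_; _*_; _-_; _^_; ∣_∣)
import Data.Integer.Properties as ℤP
open import Data.Integer.Divisibility using (_∣_)
import Data.Integer.Divisibility.Signed as Signed
import Data.Integer.DivMod as ℤDivMod
open import Data.Integer.Tactic.RingSolver using (solve-∀)
open import Data.Fin as Fin using (Fin; toℕ; inject₁; fromℕ)
import Data.Fin.Properties as FinP
open import Data.List using (List; []; _∷_; map; foldr; applyUpTo; length)
import Data.List.Properties as ListP
open import Data.List.Relation.Unary.All using (All; []; _∷_)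
import Data.List.Relation.Unary.All.Properties as AllP
open import Data.List.Relation.Unary.Any using (here; there)
open import Data.List.Membership.Propositional using (_∈_)
open import Data.List.Membership.Propositional.Properties using (∈-applyUpTo⁺)
open import Data.Product using (_×_; _,_; ∃-syntax)
open import Data.Sum as Sum using (_⊎_; inj₁; inj₂; [_,_]′)
open import Data.Empty using (⊥-elim)
open import Function using (_∘_; id; flip)
open import Level using (0ℓ)
open import Relation.Nullary using (¬_; contradiction)
open import Relation.Binary.PropositionalEquality
  using (_≡_; refl; sym; trans; cong; cong₂; subst; module ≡-Reasoning)
open import Relation.Binary.Structures using (IsEquivalence)
import Relation.Binary.Reasoning.Setoid as SetoidReasoning
open import Algebra.Bundles using (CommutativeRing)
open import Algebra.Structures using (IsCommutativeRing)
import Algebra.Properties.Semiring.Exp as SemiringExp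
import Algebra.Properties.Semiring.Mult as SemiringMult
import Algebra.Properties.Semiring.Sum as SemiringSum
import Algebra.Properties.CommutativeSemiring.Binomial as Binomial
import Algebra.Properties.Group as GroupProperties

eval : Poly → ℤ → ℤ
eval []      x = 0ℤ
eval (a ∷ f) x = a + x * eval f x

∑ : List ℤ → ℤ
∑ = foldr _+_ 0ℤ

∏ : List ℤ → ℤ
∏ = foldr _*_ 1ℤ

eval-+P : ∀ f g x → eval (f +P g) x ≡ eval f x + eval g x
eval-+P []      g       x = sym (ℤP.+-identityˡ (eval g x))
eval-+P (a ∷ f) []      x = sym (ℤP.+-identityʳ (eval (a ∷ f) x))
eval-+P (a ∷ f) (b ∷ g) x rewrite eval-+P f g x = shuffle a b x (eval f x) (eval g x)
  where
  shuffle : ∀ a b x u v → a + b + x * (u + v) ≡ a + x * u + (b + x * v)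
  shuffle = solve-∀

eval-·P : ∀ a f x → eval (a ·P f) x ≡ a * eval f x
eval-·P a []      x = sym (ℤP.*-zeroʳ a)
eval-·P a (b ∷ f) x rewrite eval-·P a f x = distrib a b x (eval f x)
  where
  distrib : ∀ a b x u → a * b + x * (a * u) ≡ a * (b + x * u)
  distrib = solve-∀

eval-negP : ∀ f x → eval (negP f) x ≡ - eval f x
eval-negP f x = trans (eval-·P -1ℤ f x) (ℤP.-1*i≡-i (eval f x))

eval-*P : ∀ f g x → eval (f *P g) x ≡ eval f x * eval g x
eval-*P []      g x = refl
eval-*P (a ∷ f) g x
  rewrite eval-+P (a ·P g) (0ℤ ∷ (f *P g)) x | eval-·P a g x | eval-*P f g x
  = distrib a x (eval f x) (eval g x)
  where
  distrib : ∀ a x u v → a * v + (0ℤ + x * (u * v)) ≡ (a + x * u) * v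
  distrib = solve-∀

eval-constP : ∀ a x → eval (constP a) x ≡ a
eval-constP a x rewrite ℤP.*-zeroʳ x = ℤP.+-identityʳ a

eval-X : ∀ x → eval X x ≡ x
eval-X x rewrite eval-constP 1ℤ x | ℤP.*-identityʳ x = ℤP.+-identityˡ x

eval-^P : ∀ f n x → eval (f ^P n) x ≡ eval f x ^ n
eval-^P f zero    x = eval-constP 1ℤ x
eval-^P f (suc n) x rewrite eval-*P f (f ^P n) x | eval-^P f n x = refl

eval-prodP : ∀ {A : Set} (g : A → Poly) L x →
             eval (prodP (map g L)) x ≡ ∏ (map (λ i → eval (g i) x) L)
eval-prodP g []      x = eval-constP 1ℤ x
eval-prodP g (i ∷ L) x rewrite eval-*P (g i) (prodP (map g L)) x | eval-prodP g L x = refl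

eval-sumP : ∀ {A : Set} (g : A → Poly) L x →
            eval (sumP (map g L)) x ≡ ∑ (map (λ i → eval (g i) x) L)
eval-sumP g []      x = refl
eval-sumP g (i ∷ L) x rewrite eval-+P (g i) (sumP (map g L)) x | eval-sumP g L x = refl

coeff-+P : ∀ f g k → coeff (f +P g) k ≡ coeff f k + coeff g k
coeff-+P []      g       k       = sym (ℤP.+-identityˡ (coeff g k))
coeff-+P (a ∷ f) []      k       = sym (ℤP.+-identityʳ (coeff (a ∷ f) k))
coeff-+P (a ∷ f) (b ∷ g) zero    = refl
coeff-+P (a ∷ f) (b ∷ g) (suc k) = coeff-+P f g k

coeff-negP : ∀ f k → coeff (negP f) k ≡ - coeff f k
coeff-negP []      k       = refl
coeff-negP (a ∷ f) zero    = ℤP.-1*i≡-i a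
coeff-negP (a ∷ f) (suc k) = coeff-negP f k

coeff-≥length : ∀ f {k} → length f ≤ k → coeff f k ≡ 0ℤ
coeff-≥length []      _         = refl
coeff-≥length (a ∷ f) (s≤s f≤k) = coeff-≥length f f≤k

monomial : ℕ → Poly
monomial zero    = oneP
monomial (suc n) = 0ℤ ∷ monomial n

eval-monomial : ∀ n x → eval (monomial n) x ≡ x ^ n
eval-monomial zero    x = eval-constP 1ℤ x
eval-monomial (suc n) x rewrite eval-monomial n x = ℤP.+-identityˡ (x * x ^ n)

coeff-monomial : ∀ n → coeff (monomial n) n ≡ 1ℤ
coeff-monomial zero    = refl
coeff-monomial (suc n) = coeff-monomial n

length-monomial : ∀ n → length (monomial n) ≡ suc n
length-monomial zero    = refl
length-monomial (suc n) = cong suc (length-monomial n)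

length-+P : ∀ {n} f g → length f ≤ n → length g ≤ n → length (f +P g) ≤ n
length-+P []      g       _          g≤n        = g≤n
length-+P (a ∷ f) []      f≤n        _          = f≤n
length-+P (a ∷ f) (b ∷ g) (s≤s f≤n) (s≤s g≤n) = s≤s (length-+P f g f≤n g≤n)

length-·P : ∀ a f → length (a ·P f) ≡ length f
length-·P a = ListP.length-map (a *_)

length-*P-linear : ∀ a b g {n} → length g ≤ suc n → length ((a ∷ b ∷ []) *P g) ≤ suc (suc n)
length-*P-linear a b g g≤1+n =
  length-+P (a ·P g) (0ℤ ∷ (b ·P g +P (0ℤ ∷ [])))
    (subst (_≤ _) (sym (length-·P a g)) (ℕP.m≤n⇒m≤1+n g≤1+n))
    (s≤s (length-+P (b ·P g) (0ℤ ∷ []) (subst (_≤ _) (sym (length-·P b g)) g≤1+n) (s≤s z≤n)))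

length-^P-linear : ∀ a b n → length ((a ∷ b ∷ []) ^P n) ≤ suc n
length-^P-linear a b zero    = s≤s z≤n
length-^P-linear a b (suc n) =
  length-*P-linear a b ((a ∷ b ∷ []) ^P n) (length-^P-linear a b n)

length-prodP-linear : ∀ {A : Set} (a b : A → ℤ) L →
                      length (prodP (map (λ i → a i ∷ b i ∷ []) L)) ≤ suc (length L)
length-prodP-linear a b []      = s≤s z≤n
length-prodP-linear a b (i ∷ L) =
  length-*P-linear (a i) (b i) (prodP (map (λ i → a i ∷ b i ∷ []) L)) (length-prodP-linear a b L)

length-sumP : ∀ {n} fs → All (λ f → length f ≤ n) fs → length (sumP fs) ≤ n
length-sumP []       []           = z≤n
length-sumP (f ∷ fs) (f≤n ∷ fs≤n) = length-+P f (sumP fs) f≤n (length-sumP fs fs≤n)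

quotientBy : ℤ → Poly → Poly
quotientBy a []              = []
quotientBy a (b ∷ [])        = []
quotientBy a (b ∷ f@(_ ∷ _)) = eval f a ∷ quotientBy a f

eval-quotientBy : ∀ a f x → eval f x ≡ (x - a) * eval (quotientBy a f) x + eval f a
eval-quotientBy a []              x = constant 0ℤ x a
  where
  constant : ∀ b x a → b ≡ (x - a) * 0ℤ + b
  constant = solve-∀
eval-quotientBy a (b ∷ [])        x = constant b x a
  where
  constant : ∀ b x a → b + x * 0ℤ ≡ (x - a) * 0ℤ + (b + a * 0ℤ)
  constant = solve-∀
eval-quotientBy a (b ∷ f@(_ ∷ _)) x rewrite eval-quotientBy a f x =
  divide b x a (eval (quotientBy a f) x) (eval f a)
  where
  divide : ∀ b x a q r → b + x * ((x - a) * q + r) ≡ (x - a) * (r + x * q) + (b + a * r)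
  divide = solve-∀

private
  0≡0-a*0 : ∀ a → 0ℤ ≡ 0ℤ - a * 0ℤ
  0≡0-a*0 a = sym (cong (λ t → 0ℤ - t) (ℤP.*-zeroʳ a))

coeff-quotientBy-zero : ∀ a f → coeff f 0 ≡ eval f a - a * coeff (quotientBy a f) 0
coeff-quotientBy-zero a []              = 0≡0-a*0 a
coeff-quotientBy-zero a (b ∷ [])        = cancel b a 0ℤ
  where
  cancel : ∀ b a r → b ≡ b + a * r - a * r
  cancel = solve-∀
coeff-quotientBy-zero a (b ∷ f@(_ ∷ _)) = cancel b a (eval f a)
  where
  cancel : ∀ b a r → b ≡ b + a * r - a * r
  cancel = solve-∀

coeff-quotientBy-suc : ∀ a f k →
  coeff f (suc k) ≡ coeff (quotientBy a f) k - a * coeff (quotientBy a f) (suc k)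
coeff-quotientBy-suc a []              k       = 0≡0-a*0 a
coeff-quotientBy-suc a (b ∷ [])        k       = 0≡0-a*0 a
coeff-quotientBy-suc a (b ∷ f@(_ ∷ _)) zero    = coeff-quotientBy-zero a f
coeff-quotientBy-suc a (b ∷ f@(_ ∷ _)) (suc k) = coeff-quotientBy-suc a f k

length-quotientBy : ∀ a f {n} → length f ≤ suc n → length (quotientBy a f) ≤ n
length-quotientBy a []              _                 = z≤n
length-quotientBy a (b ∷ [])        _                 = z≤n
length-quotientBy a (b ∷ f@(_ ∷ _)) {suc n} (s≤s f≤n) = s≤s (length-quotientBy a f f≤n)

∏-map-*ʳ : ∀ {A : Set} (f : A → ℤ) t L →
           ∏ (map (λ i → f i * t) L) ≡ ∏ (map f L) * t ^ length L
∏-map-*ʳ f t []      = refl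
∏-map-*ʳ f t (i ∷ L) rewrite ∏-map-*ʳ f t L =
  interchange (f i) t (∏ (map f L)) (t ^ length L)
  where
  interchange : ∀ a t u v → a * t * (u * v) ≡ a * u * (t * v)
  interchange = solve-∀

∏-map-const : ∀ {A : Set} t (L : List A) → ∏ (map (λ _ → t) L) ≡ t ^ length L
∏-map-const t []      = refl
∏-map-const t (i ∷ L) = cong (t *_) (∏-map-const t L)

∑-map-const-1 : ∀ {A : Set} (L : List A) → ∑ (map (λ _ → 1ℤ) L) ≡ + length L
∑-map-const-1 []      = refl
∑-map-const-1 (i ∷ L) = cong (λ s → 1ℤ + s) (∑-map-const-1 L)

∑-map-*ˡ : ∀ a xs → ∑ (map (a *_) xs) ≡ a * ∑ xs
∑-map-*ˡ a []       = sym (ℤP.*-zeroʳ a)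
∑-map-*ˡ a (x ∷ xs) =
  trans (cong (λ s → a * x + s) (∑-map-*ˡ a xs)) (sym (ℤP.*-distribˡ-+ a x (∑ xs)))

∑-powers-shift : ∀ x n → ∑ (applyUpTo (λ i → x ^ suc i) n) ≡ x * ∑ (applyUpTo (x ^_) n)
∑-powers-shift x n =
  trans (cong ∑ (sym (ListP.map-applyUpTo (x ^_) (x *_) n))) (∑-map-*ˡ x (applyUpTo (x ^_) n))

geometric-sum : ∀ x n → (x - 1ℤ) * ∑ (applyUpTo (x ^_) n) ≡ x ^ n - 1ℤ
geometric-sum x zero    = ℤP.*-zeroʳ (x - 1ℤ)
geometric-sum x (suc n) = begin
  (x - 1ℤ) * (1ℤ + ∑ (applyUpTo (λ i → x ^ suc i) n))
    ≡⟨ cong (λ s → (x - 1ℤ) * (1ℤ + s)) (∑-powers-shift x n) ⟩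
  (x - 1ℤ) * (1ℤ + x * S)      ≡⟨ expand x S ⟩
  x - 1ℤ + x * ((x - 1ℤ) * S)  ≡⟨ cong (λ t → x - 1ℤ + x * t) (geometric-sum x n) ⟩
  x - 1ℤ + x * (x ^ n - 1ℤ)    ≡⟨ collapse x (x ^ n) ⟩
  x * x ^ n - 1ℤ               ∎
  where
  open ≡-Reasoning
  S = ∑ (applyUpTo (x ^_) n)
  expand : ∀ x s → (x - 1ℤ) * (1ℤ + x * s) ≡ x - 1ℤ + x * ((x - 1ℤ) * s)
  expand = solve-∀
  collapse : ∀ x y → x - 1ℤ + x * (y - 1ℤ) ≡ x * y - 1ℤ
  collapse = solve-∀

length-oneTo : ∀ n → length (oneTo n) ≡ n
length-oneTo = ListP.length-applyUpTo suc

eval-factor : ∀ c i x → eval (factor c i) x ≡ c + + i * (x - 1ℤ)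
eval-factor c i x = rearrange c (+ i) x
  where
  rearrange : ∀ c i x → c - i + x * (i + x * 0ℤ) ≡ c + i * (x - 1ℤ)
  rearrange = solve-∀

eval-lhs : ∀ p c x → eval (lhs p c) x ≡ ∏ (map (λ i → c + + i * (x - 1ℤ)) (oneTo (p ∸ 1)))
eval-lhs p c x = trans (eval-prodP (factor c) (oneTo (p ∸ 1)) x)
                       (cong ∏ (ListP.map-cong (λ i → eval-factor c i x) (oneTo (p ∸ 1))))

eval-rhsDiv : ∀ p x → eval (rhsDiv p) x ≡ - (x - 1ℤ) ^ (p ∸ 1)
eval-rhsDiv p x = begin
  eval (rhsDiv p) x                             ≡⟨ eval-negP (X-1 ^P (p ∸ 1)) x ⟩
  - eval (X-1 ^P (p ∸ 1)) x                     ≡⟨ cong -_ (eval-^P X-1 (p ∸ 1) x) ⟩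
  - eval X-1 x ^ (p ∸ 1)
    ≡⟨ cong (λ y → - y ^ (p ∸ 1)) (eval-+P X (constP -1ℤ) x) ⟩
  - (eval X x + eval (constP -1ℤ) x) ^ (p ∸ 1)
    ≡⟨ cong (λ y → - y ^ (p ∸ 1)) (cong₂ _+_ (eval-X x) (eval-constP -1ℤ x)) ⟩
  - (x - 1ℤ) ^ (p ∸ 1)                          ∎
  where
  open ≡-Reasoning
  X-1 = X +P constP -1ℤ

eval-rhsNotDiv : ∀ p x → eval (rhsNotDiv p) x ≡ - ∑ (map (x ^_) (oneTo (p ∸ 1)))
eval-rhsNotDiv p x = begin
  eval (rhsNotDiv p) x                    ≡⟨ eval-negP (sumP (map (X ^P_) L)) x ⟩
  - eval (sumP (map (X ^P_) L)) x         ≡⟨ cong -_ (eval-sumP (X ^P_) L x) ⟩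
  - ∑ (map (λ j → eval (X ^P j) x) L)     ≡⟨ cong (λ xs → - ∑ xs) (ListP.map-cong eval-X^P L) ⟩
  - ∑ (map (x ^_) L)                      ∎
  where
  open ≡-Reasoning
  L = oneTo (p ∸ 1)
  eval-X^P : ∀ j → eval (X ^P j) x ≡ x ^ j
  eval-X^P j = trans (eval-^P X j x) (cong (_^ j) (eval-X x))

length-lhs : ∀ p c → length (lhs p c) ≤ suc (p ∸ 1)
length-lhs p c = subst (λ n → length (lhs p c) ≤ suc n) (length-oneTo (p ∸ 1))
                   (length-prodP-linear (λ i → c - + i) +_ (oneTo (p ∸ 1)))

length-rhsDiv : ∀ p → length (rhsDiv p) ≤ suc (p ∸ 1)
length-rhsDiv p = subst (_≤ suc (p ∸ 1)) (sym (length-·P -1ℤ ((X +P constP -1ℤ) ^P (p ∸ 1))))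
                    (length-^P-linear (0ℤ + -1ℤ) 1ℤ (p ∸ 1))

length-rhsNotDiv : ∀ p → length (rhsNotDiv p) ≤ suc (p ∸ 1)
length-rhsNotDiv p = subst (_≤ suc (p ∸ 1)) (sym (length-·P -1ℤ (sumP (map (X ^P_) L))))
  (length-sumP (map (X ^P_) L) (AllP.map⁺ (AllP.applyUpTo⁺₁ suc (p ∸ 1) X^[1+i]≤p)))
  where
  L = oneTo (p ∸ 1)
  X^[1+i]≤p : ∀ {i} → i < p ∸ 1 → length (X ^P suc i) ≤ suc (p ∸ 1)
  X^[1+i]≤p {i} i<p-1 = ℕP.≤-trans (length-^P-linear 0ℤ 1ℤ (suc i)) (s≤s i<p-1)

p∤k! : ∀ {p} → Prime p → ∀ k → k < p → ¬ (p ℕDiv.∣ k ℕ.!)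
p∤k! {p} p-prime zero    _   = ℕDiv.>⇒∤ (ℕ.nonTrivial⇒n>1 p ⦃ prime⇒nonTrivial p-prime ⦄)
p∤k! p-prime (suc k) k<p p∣k+1! with euclidsLemma (suc k) (k ℕ.!) p-prime p∣k+1!
... | inj₁ p∣k+1 = ℕP.<⇒≱ k<p (ℕDiv.∣⇒≤ p∣k+1)
... | inj₂ p∣k!  = p∤k! p-prime k (ℕP.<-trans (ℕP.n<1+n k) k<p) p∣k!

-- k! (p - k)! (p C k) = p!, and p divides neither factorial.
p∣pCk : ∀ {p} → Prime p → ∀ {k} → 0 < k → k < p → p ℕDiv.∣ p C k
p∣pCk {suc n} p-prime {k} 0<k k<p =
  [ flip contradiction p∤d , id ]′ (euclidsLemma d (suc n C k) p-prime p∣d*pCk)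
  where
  p = suc n
  k≤p = ℕP.<⇒≤ k<p
  d = k ℕ.! ℕ.* (p ∸ k) ℕ.!
  instance
    d≢0 : ℕ.NonZero d
    d≢0 = k ℕP.!* (p ∸ k) !≢0
  p∤d : ¬ (p ℕDiv.∣ d)
  p∤d p∣d = [ p∤k! p-prime k k<p , p∤k! p-prime (p ∸ k) (ℕP.∸-monoʳ-< {p} {k} {0} 0<k k≤p) ]′
              (euclidsLemma (k ℕ.!) ((p ∸ k) ℕ.!) p-prime p∣d)
  d*pCk≡p! : d ℕ.* (p C k) ≡ p ℕ.!
  d*pCk≡p! = trans (cong (d ℕ.*_) (nCk≡n!/k![n-k]! k≤p)) (ℕDivMod.m*[n/m]≡n (k![n∸k]!∣n! k≤p))
  p∣d*pCk : p ℕDiv.∣ d ℕ.* (p C k)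
  p∣d*pCk = subst (p ℕDiv.∣_) (sym d*pCk≡p!) (ℕDiv.m∣m*n (n ℕ.!))

module Modulo (n : ℤ) where

  infix 4 _≈_ _≉_

  record _≈_ (a b : ℤ) : Set where
    constructor congruent
    field n∣a-b : n Signed.∣ a - b

  open _≈_ public

  _≉_ : ℤ → ℤ → Set
  a ≉ b = ¬ (a ≈ b)

  private
    congruent-via : ∀ {d a b} → n Signed.∣ d → d ≡ a - b → a ≈ b
    congruent-via n∣d refl = congruent n∣d

  ≡⇒≈ : ∀ {a b} → a ≡ b → a ≈ b
  ≡⇒≈ {a} refl = congruent (Signed.divides 0ℤ (ℤP.+-inverseʳ a))

  ≈-refl : ∀ {a} → a ≈ a
  ≈-refl = ≡⇒≈ refl

  ≈-sym : ∀ {a b} → a ≈ b → b ≈ a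
  ≈-sym {a} {b} (congruent n∣a-b) = congruent-via (Signed.∣m⇒∣-m n∣a-b) (swap a b)
    where
    swap : ∀ a b → - (a - b) ≡ b - a
    swap = solve-∀

  ≈-trans : ∀ {a b c} → a ≈ b → b ≈ c → a ≈ c
  ≈-trans {a} {b} {c} (congruent n∣a-b) (congruent n∣b-c) =
    congruent-via (Signed.∣m∣n⇒∣m+n n∣a-b n∣b-c) (telescope a b c)
    where
    telescope : ∀ a b c → a - b + (b - c) ≡ a - c
    telescope = solve-∀

  +-cong : ∀ {a b c d} → a ≈ b → c ≈ d → a + c ≈ b + d
  +-cong {a} {b} {c} {d} (congruent n∣a-b) (congruent n∣c-d) =
    congruent-via (Signed.∣m∣n⇒∣m+n n∣a-b n∣c-d) (regroup a b c d)
    where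
    regroup : ∀ a b c d → a - b + (c - d) ≡ a + c - (b + d)
    regroup = solve-∀

  *-cong : ∀ {a b c d} → a ≈ b → c ≈ d → a * c ≈ b * d
  *-cong {a} {b} {c} {d} (congruent n∣a-b) (congruent n∣c-d) =
    congruent-via (Signed.∣m∣n⇒∣m+n (Signed.∣n⇒∣m*n c n∣a-b) (Signed.∣n⇒∣m*n b n∣c-d))
                  (regroup a b c d)
    where
    regroup : ∀ a b c d → c * (a - b) + b * (c - d) ≡ a * c - b * d
    regroup = solve-∀

  -‿cong : ∀ {a b} → a ≈ b → - a ≈ - b
  -‿cong {a} {b} (congruent n∣a-b) = congruent-via (Signed.∣m⇒∣-m n∣a-b) (negate a b)
    where
    negate : ∀ a b → - (a - b) ≡ - a - - b
    negate = solve-∀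

  ∣⇒≈0 : ∀ {a} → n Signed.∣ a → a ≈ 0ℤ
  ∣⇒≈0 {a} n∣a = congruent-via n∣a (sym (ℤP.+-identityʳ a))

  ≈0⇒∣ : ∀ {a} → a ≈ 0ℤ → n Signed.∣ a
  ≈0⇒∣ {a} (congruent n∣a-0) = subst (n Signed.∣_) (ℤP.+-identityʳ a) n∣a-0

  ≈⇒-≈0 : ∀ {a b} → a ≈ b → a - b ≈ 0ℤ
  ≈⇒-≈0 (congruent n∣a-b) = ∣⇒≈0 n∣a-b

  -≈0⇒≈ : ∀ {a b} → a - b ≈ 0ℤ → a ≈ b
  -≈0⇒≈ a-b≈0 = congruent (≈0⇒∣ a-b≈0)

  isEquivalence : IsEquivalence _≈_
  isEquivalence = record { refl = ≈-refl ; sym = ≈-sym ; trans = ≈-trans }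

  isCommutativeRing : IsCommutativeRing _≈_ _+_ _*_ -_ 0ℤ 1ℤ
  isCommutativeRing = record
    { isRing = record
      { +-isAbelianGroup = record
        { isGroup = record
          { isMonoid = record
            { isSemigroup = record
              { isMagma = record { isEquivalence = isEquivalence ; ∙-cong = +-cong }
              ; assoc   = λ a b c → ≡⇒≈ (ℤP.+-assoc a b c)
              }
            ; identity = ≡⇒≈ ∘ ℤP.+-identityˡ , ≡⇒≈ ∘ ℤP.+-identityʳ
            }
          ; inverse = ≡⇒≈ ∘ ℤP.+-inverseˡ , ≡⇒≈ ∘ ℤP.+-inverseʳ
          ; ⁻¹-cong = -‿cong
          }
        ; comm = λ a b → ≡⇒≈ (ℤP.+-comm a b)
        }
      ; *-cong     = *-cong
      ; *-assoc    = λ a b c → ≡⇒≈ (ℤP.*-assoc a b c)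
      ; *-identity = ≡⇒≈ ∘ ℤP.*-identityˡ , ≡⇒≈ ∘ ℤP.*-identityʳ
      ; distrib    = (λ a b c → ≡⇒≈ (ℤP.*-distribˡ-+ a b c))
                   , (λ a b c → ≡⇒≈ (ℤP.*-distribʳ-+ a b c))
      }
    ; *-comm = λ a b → ≡⇒≈ (ℤP.*-comm a b)
    }

  commutativeRing : CommutativeRing 0ℓ 0ℓ
  commutativeRing = record { isCommutativeRing = isCommutativeRing }

  open CommutativeRing commutativeRing using (semiring)
  open SemiringExp semiring public using () renaming (_^_ to _^ᴿ_)
  open SemiringMult semiring public using () renaming (_×_ to _×ᴿ_)

  ^ᴿ≡^ : ∀ x k → x ^ᴿ k ≡ x ^ k
  ^ᴿ≡^ x zero    = refl
  ^ᴿ≡^ x (suc k) = cong (x *_) (^ᴿ≡^ x k)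

  ×ᴿ≡* : ∀ k x → k ×ᴿ x ≡ + k * x
  ×ᴿ≡* zero    x = refl
  ×ᴿ≡* (suc k) x = trans (cong (λ y → x + y) (×ᴿ≡* k x)) (sym (ℤP.suc-* (+ k) x))

  ∏-cong : ∀ {A : Set} {f g : A → ℤ} L → (∀ i → f i ≈ g i) → ∏ (map f L) ≈ ∏ (map g L)
  ∏-cong []      f≈g = ≈-refl
  ∏-cong (i ∷ L) f≈g = *-cong (f≈g i) (∏-cong L f≈g)

  ∏≈0 : ∀ {A : Set} (f : A → ℤ) L {i} → i ∈ L → f i ≈ 0ℤ → ∏ (map f L) ≈ 0ℤ
  ∏≈0 f (j ∷ L) (here refl) fi≈0 = *-cong fi≈0 (≈-refl {∏ (map f L)})
  ∏≈0 f (j ∷ L) (there i∈L) fi≈0 =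
    ≈-trans (*-cong (≈-refl {f j}) (∏≈0 f L i∈L fi≈0)) (≡⇒≈ (ℤP.*-zeroʳ (f j)))

-- Writing the prime as 2 + m makes  p ∸ 1  compute to  suc m.
module ModuloPrime (m : ℕ) (p-prime : Prime (suc (suc m))) where

  p : ℕ
  p = suc (suc m)

  open Modulo (+ p)
  open CommutativeRing commutativeRing using (semiring; commutativeSemiring; +-group; setoid)
  open SemiringSum semiring using (sum; sum-cong-≋; sum-init-last; sum-replicate-zero)
  open GroupProperties +-group using (∙-cancelˡ)
  open SetoidReasoning setoid

  x*y≈0⇒x≈0∨y≈0 : ∀ x y → x * y ≈ 0ℤ → x ≈ 0ℤ ⊎ y ≈ 0ℤ
  x*y≈0⇒x≈0∨y≈0 x y xy≈0 =
    Sum.map (∣⇒≈0 ∘ Signed.∣ᵤ⇒∣) (∣⇒≈0 ∘ Signed.∣ᵤ⇒∣) (euclidsLemma ∣ x ∣ ∣ y ∣ p-prime p∣∣x∣∣y∣)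
    where
    p∣∣x∣∣y∣ : p ℕDiv.∣ ∣ x ∣ ℕ.* ∣ y ∣
    p∣∣x∣∣y∣ = subst (p ℕDiv.∣_) (ℤP.abs-* x y) (Signed.∣⇒∣ᵤ (≈0⇒∣ xy≈0))

  i<j<p⇒j≉i : ∀ {i j} → i < j → j < p → + j ≉ + i
  i<j<p⇒j≉i {i} {j} i<j j<p (congruent p∣j-i) =
    ℕP.<⇒≱ j<p (ℕP.≤-trans p≤j∸i (ℕP.m∸n≤m j i))
    where
    j-i≡j∸i : + j - + i ≡ + (j ∸ i)
    j-i≡j∸i = trans (ℤP.m-n≡m⊖n j i) (ℤP.⊖-≥ (ℕP.<⇒≤ i<j))
    p≤j∸i : p ≤ j ∸ i
    p≤j∸i = ℕDiv.∣⇒≤ ⦃ ℕ.>-nonZero (ℕP.m<n⇒0<n∸m i<j) ⦄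
              (Signed.∣⇒∣ᵤ (subst (Signed._∣_ (+ p)) j-i≡j∸i p∣j-i))

  x≈x%ℕp : ∀ x → x ≈ + (x ℤDivMod.%ℕ p)
  x≈x%ℕp x =
    congruent (Signed.divides q (trans (cong (_- + r) (ℤDivMod.a≡a%ℕn+[a/ℕn]*n x p))
                                       (cancel (+ r) (q * + p))))
    where
    q = x ℤDivMod./ℕ p
    r = x ℤDivMod.%ℕ p
    cancel : ∀ r s → r + s - r ≡ s
    cancel = solve-∀

  pCk*y≈0 : ∀ {k} → 0 < k → k < p → ∀ y → + (p C k) * y ≈ 0ℤ
  pCk*y≈0 {k} 0<k k<p y =
    ∣⇒≈0 (Signed.∣m⇒∣m*n {m = + (p C k)} y (Signed.∣ᵤ⇒∣ (p∣pCk p-prime 0<k k<p)))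

  freshmansDream : ∀ x → (1ℤ + x) ^ p ≈ 1ℤ + x ^ p
  freshmansDream x = begin
    (1ℤ + x) ^ p                          ≡⟨ ^ᴿ≡^ (1ℤ + x) p ⟨
    (1ℤ + x) ^ᴿ p                         ≈⟨ Binomial.theorem commutativeSemiring p 1ℤ x ⟩
    term Fin.zero + sum (term ∘ Fin.suc)
      ≈⟨ +-cong (≈-refl {term Fin.zero}) (sum-init-last (term ∘ Fin.suc)) ⟩
    term Fin.zero + (sum middle + term (fromℕ p))
      ≈⟨ +-cong (≡⇒≈ first) (+-cong middle≈0 (≡⇒≈ last)) ⟩
    x ^ p + (0ℤ + 1ℤ)                     ≡⟨ ℤP.+-comm (x ^ p) 1ℤ ⟩
    1ℤ + x ^ p                            ∎
    where
    open Binomial commutativeSemiring using (binomialTerm)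
    term : Fin (suc p) → ℤ
    term = binomialTerm 1ℤ x p
    term≡ : ∀ k → term k ≡ + (p C toℕ k) * x ^ (p ∸ toℕ k)
    term≡ k = trans (×ᴿ≡* (p C toℕ k) _) (cong (+ (p C toℕ k) *_) (trans
                (cong₂ _*_ (trans (^ᴿ≡^ 1ℤ (toℕ k)) (ℤP.^-zeroˡ (toℕ k))) (^ᴿ≡^ x (p ∸ toℕ k)))
                (ℤP.*-identityˡ (x ^ (p ∸ toℕ k)))))
    first : term Fin.zero ≡ x ^ p
    first = trans (term≡ Fin.zero) (ℤP.*-identityˡ (x ^ p))
    last : term (fromℕ p) ≡ 1ℤ
    last = trans (term≡ (fromℕ p))
             (trans (cong (λ j → + (p C j) * x ^ (p ∸ j)) (FinP.toℕ-fromℕ p))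
                    (cong₂ (λ c j → + c * x ^ j) (nCn≡1 p) (ℕP.n∸n≡0 p)))
    middle : Fin (suc m) → ℤ
    middle k = term (Fin.suc (inject₁ k))
    middle≈0 : sum middle ≈ 0ℤ
    middle≈0 = ≈-trans (sum-cong-≋ vanishes) (sum-replicate-zero (suc m))
      where
      vanishes : ∀ k → middle k ≈ 0ℤ
      vanishes k = ≈-trans (≡⇒≈ (term≡ (Fin.suc (inject₁ k)))) (pCk*y≈0 (s≤s z≤n) j<p _)
        where
        j<p : suc (toℕ (inject₁ k)) < p
        j<p = s≤s (subst (_< suc m) (sym (FinP.toℕ-inject₁ k)) (FinP.toℕ<n k))

  x^p≈x-pred : ∀ x → (1ℤ + x) ^ p ≈ 1ℤ + x → x ^ p ≈ x
  x^p≈x-pred x [1+x]^p≈1+x =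
    ∙-cancelˡ 1ℤ (x ^ p) x (≈-trans (≈-sym (freshmansDream x)) [1+x]^p≈1+x)

  x^p≈x : ∀ x → x ^ p ≈ x
  x^p≈x (+ zero)     = ≈-refl
  x^p≈x +[1+ n ]     = ≈-trans (freshmansDream (+ n)) (+-cong (≈-refl {1ℤ}) (x^p≈x (+ n)))
  x^p≈x -[1+ zero ]  = x^p≈x-pred -1ℤ (x^p≈x 0ℤ)
  x^p≈x -[1+ suc n ] = x^p≈x-pred -[1+ suc n ] (x^p≈x -[1+ n ])

  x^[p-1]≈1 : ∀ {x} → x ≉ 0ℤ → x ^ suc m ≈ 1ℤ
  x^[p-1]≈1 {x} x≉0 =
    [ flip contradiction x≉0 , -≈0⇒≈ ]′ (x*y≈0⇒x≈0∨y≈0 x (x ^ suc m - 1ℤ) x[x^[p-1]-1]≈0)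
    where
    expand : ∀ x y → x * (y - 1ℤ) ≡ x * y - x
    expand = solve-∀
    x[x^[p-1]-1]≈0 : x * (x ^ suc m - 1ℤ) ≈ 0ℤ
    x[x^[p-1]-1]≈0 = ≈-trans (≡⇒≈ (expand x (x ^ suc m))) (≈⇒-≈0 (x^p≈x x))

  Distinct : (ℕ → ℤ) → ℕ → Set
  Distinct a n = ∀ {i j} → i < j → j < n → a j ≉ a i

  Roots : Poly → (ℕ → ℤ) → ℕ → Set
  Roots f a n = ∀ {i} → i < n → eval f (a i) ≈ 0ℤ

  root-quotientBy : ∀ f {a b} → eval f a ≈ 0ℤ → eval f b ≈ 0ℤ → b ≉ a →
                    eval (quotientBy a f) b ≈ 0ℤ
  root-quotientBy f {a} {b} fa≈0 fb≈0 b≉a =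
    [ flip contradiction b≉a ∘ -≈0⇒≈ , id ]′ (x*y≈0⇒x≈0∨y≈0 (b - a) (eval q b) [b-a]qb≈0)
    where
    q = quotientBy a f
    cancel : ∀ u r → u ≡ u + r - r
    cancel = solve-∀
    [b-a]qb≈0 : (b - a) * eval q b ≈ 0ℤ
    [b-a]qb≈0 = begin
      (b - a) * eval q b                        ≡⟨ cancel ((b - a) * eval q b) (eval f a) ⟩
      (b - a) * eval q b + eval f a - eval f a  ≡⟨ cong (_- eval f a) (eval-quotientBy a f b) ⟨
      eval f b - eval f a                       ≈⟨ ≈⇒-≈0 (≈-trans fb≈0 (≈-sym fa≈0)) ⟩
      0ℤ                                        ∎

  roots-quotientBy : ∀ f a n → Distinct a (suc n) → Roots f a (suc n) →
                     Roots (quotientBy (a 0) f) (a ∘ suc) n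
  roots-quotientBy f a n distinct roots i<n =
    root-quotientBy f (roots (s≤s z≤n)) (roots (s≤s i<n)) (distinct (s≤s z≤n) (s≤s i<n))

  roots⇒coeff≈0 : ∀ n f a → length f ≤ n → Distinct a n → Roots f a n → ∀ k → coeff f k ≈ 0ℤ
  roots⇒coeff≈0 zero    []  a _ _ _ k = ≈-refl
  roots⇒coeff≈0 (suc n) f a f≤1+n distinct roots = coeff≈0
    where
    q = quotientBy (a 0) f
    q≈0 : ∀ k → coeff q k ≈ 0ℤ
    q≈0 = roots⇒coeff≈0 n q (a ∘ suc) (length-quotientBy (a 0) f f≤1+n)
            (λ i<j j<n → distinct (s≤s i<j) (s≤s j<n)) (roots-quotientBy f a n distinct roots)
    combination≈0 : ∀ {u v} → u ≈ 0ℤ → v ≈ 0ℤ → u - a 0 * v ≈ 0ℤ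
    combination≈0 u≈0 v≈0 =
      ≈-trans (+-cong u≈0 (-‿cong (*-cong (≈-refl {a 0}) v≈0))) (≡⇒≈ (sym (0≡0-a*0 (a 0))))
    coeff≈0 : ∀ k → coeff f k ≈ 0ℤ
    coeff≈0 zero    = ≈-trans (≡⇒≈ (coeff-quotientBy-zero (a 0) f))
                              (combination≈0 (roots (s≤s z≤n)) (q≈0 0))
    coeff≈0 (suc k) = ≈-trans (≡⇒≈ (coeff-quotientBy-suc (a 0) f k))
                              (combination≈0 (q≈0 k) (q≈0 (suc k)))

  roots⇒eval≈lead*∏ : ∀ n f a → length f ≤ suc n → Distinct a n → Roots f a n →
                      ∀ x → eval f x ≈ coeff f n * ∏ (applyUpTo (λ i → x - a i) n)
  roots⇒eval≈lead*∏ zero    []          a _        _ _ x = ≈-refl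
  roots⇒eval≈lead*∏ zero    (b ∷ [])    a _        _ _ x = ≡⇒≈ (constant b x)
    where
    constant : ∀ b x → b + x * 0ℤ ≡ b * 1ℤ
    constant = solve-∀
  roots⇒eval≈lead*∏ zero    (_ ∷ _ ∷ _) a (s≤s ()) _ _ x
  roots⇒eval≈lead*∏ (suc n) f a f≤2+n distinct roots x = begin
    eval f x                             ≡⟨ eval-quotientBy (a 0) f x ⟩
    (x - a 0) * eval q x + eval f (a 0)  ≈⟨ +-cong (*-cong (≈-refl {x - a 0}) q≈) (roots (s≤s z≤n)) ⟩
    (x - a 0) * (coeff q n * Π) + 0ℤ     ≡⟨ regroup (x - a 0) (coeff q n) Π ⟩
    coeff q n * ((x - a 0) * Π)          ≡⟨ cong (_* ((x - a 0) * Π)) lead-q≡lead-f ⟩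
    coeff f (suc n) * ((x - a 0) * Π)    ∎
    where
    q = quotientBy (a 0) f
    Π = ∏ (applyUpTo (λ i → x - a (suc i)) n)
    q≤1+n : length q ≤ suc n
    q≤1+n = length-quotientBy (a 0) f f≤2+n
    q≈ : eval q x ≈ coeff q n * Π
    q≈ = roots⇒eval≈lead*∏ n q (a ∘ suc) q≤1+n
           (λ i<j j<n → distinct (s≤s i<j) (s≤s j<n)) (roots-quotientBy f a n distinct roots) x
    regroup : ∀ y c π → y * (c * π) + 0ℤ ≡ c * (y * π)
    regroup = solve-∀
    drop : ∀ c a → c - a * 0ℤ ≡ c
    drop = solve-∀
    lead-q≡lead-f : coeff q n ≡ coeff f (suc n)
    lead-q≡lead-f = sym (trans (coeff-quotientBy-suc (a 0) f n)
                               (trans (cong (λ c → coeff q n - a 0 * c) (coeff-≥length q q≤1+n))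
                                      (drop (coeff q n) (a 0))))

  -- The roots of  x^(p-1) - 1  are  -1, …, -(p - 1); compare its values at 0.
  wilson : ∏ (map +_ (oneTo (p ∸ 1))) ≈ -1ℤ
  wilson = begin
    ∏ (map +_ (applyUpTo suc (suc m)))  ≡⟨ cong ∏ (ListP.map-applyUpTo suc +_ (suc m)) ⟩
    Π                                   ≡⟨ trans (cong (_* Π) (coeff-monomial m)) (ℤP.*-identityˡ Π) ⟨
    coeff W (suc m) * Π                 ≈⟨ roots⇒eval≈lead*∏ (suc m) W -[1+_] W≤p distinct roots 0ℤ ⟨
    eval W 0ℤ                           ≡⟨⟩
    -1ℤ                                 ∎
    where
    Π = ∏ (applyUpTo (λ i → 0ℤ - -[1+ i ]) (suc m))
    W : Poly
    W = -1ℤ ∷ monomial m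
    W≤p : length W ≤ p
    W≤p = ℕP.≤-reflexive (cong suc (length-monomial m))
    distinct : Distinct -[1+_] (suc m)
    distinct i<j j<p-1 = i<j<p⇒j≉i (s≤s i<j) (s≤s j<p-1) ∘ -‿cong
    roots : Roots W -[1+_] (suc m)
    roots {i} i<p-1 = begin
      -1ℤ + -[1+ i ] * eval (monomial m) -[1+ i ]
        ≡⟨ cong (λ y → -1ℤ + -[1+ i ] * y) (eval-monomial m -[1+ i ]) ⟩
      -1ℤ + -[1+ i ] ^ suc m            ≈⟨ +-cong (≈-refl { -1ℤ}) (x^[p-1]≈1 -[1+i]≉0) ⟩
      0ℤ                                ∎
      where
      -[1+i]≉0 : -[1+ i ] ≉ 0ℤ
      -[1+i]≉0 = i<j<p⇒j≉i (s≤s z≤n) (s≤s i<p-1) ∘ -‿cong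

  -- The root is  i ≡ - c y^(p-2),  as y^(p-2) inverts y by Fermat.
  linear-root : ∀ {c y} → c ≉ 0ℤ → y ≉ 0ℤ → ∃[ i ] (i ∈ oneTo (p ∸ 1) × c + + i * y ≈ 0ℤ)
  linear-root {c} {y} c≉0 y≉0 = positive (t ℤDivMod.%ℕ p) (ℤDivMod.n%ℕd<d t p) root
    where
    t = - c * y ^ m
    regroup : ∀ c y z → c + - c * z * y ≡ c - c * (y * z)
    regroup = solve-∀
    cancel : ∀ c → c - c * 1ℤ ≡ 0ℤ
    cancel = solve-∀
    root : c + + (t ℤDivMod.%ℕ p) * y ≈ 0ℤ
    root = begin
      c + + (t ℤDivMod.%ℕ p) * y  ≈⟨ +-cong (≈-refl {c}) (*-cong (≈-sym (x≈x%ℕp t)) (≈-refl {y})) ⟩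
      c + t * y                   ≡⟨ regroup c y (y ^ m) ⟩
      c - c * y ^ suc m           ≈⟨ +-cong (≈-refl {c}) (-‿cong (*-cong (≈-refl {c}) (x^[p-1]≈1 y≉0))) ⟩
      c - c * 1ℤ                  ≡⟨ cancel c ⟩
      0ℤ                          ∎
    positive : ∀ i → i < p → c + + i * y ≈ 0ℤ → ∃[ i ] (i ∈ oneTo (p ∸ 1) × c + + i * y ≈ 0ℤ)
    positive zero    _           c≈0  = ⊥-elim (c≉0 (≈-trans (≡⇒≈ (sym (ℤP.+-identityʳ c))) c≈0))
    positive (suc i) (s≤s i<p-1) root = suc i , ∈-applyUpTo⁺ suc i<p-1 , root

  lhs≈rhsDiv : ∀ {c} → c ≈ 0ℤ → ∀ x → eval (lhs p c) x ≈ eval (rhsDiv p) x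
  lhs≈rhsDiv {c} c≈0 x = begin
    eval (lhs p c) x                ≡⟨ eval-lhs p c x ⟩
    ∏ (map (λ i → c + + i * y) L)   ≈⟨ ∏-cong L drop-c ⟩
    ∏ (map (λ i → + i * y) L)       ≡⟨ ∏-map-*ʳ +_ y L ⟩
    ∏ (map +_ L) * y ^ length L     ≈⟨ *-cong wilson (≡⇒≈ (cong (y ^_) (length-oneTo (p ∸ 1)))) ⟩
    -1ℤ * y ^ (p ∸ 1)               ≡⟨ ℤP.-1*i≡-i (y ^ (p ∸ 1)) ⟩
    - y ^ (p ∸ 1)                   ≡⟨ eval-rhsDiv p x ⟨
    eval (rhsDiv p) x               ∎
    where
    y = x - 1ℤ
    L = oneTo (p ∸ 1)
    drop-c : ∀ i → c + + i * y ≈ + i * y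
    drop-c i = ≈-trans (+-cong c≈0 (≈-refl {+ i * y})) (≡⇒≈ (ℤP.+-identityˡ (+ i * y)))

  lhs-at-1 : ∀ {c} → c ≉ 0ℤ → eval (lhs p c) 1ℤ ≈ 1ℤ
  lhs-at-1 {c} c≉0 = begin
    eval (lhs p c) 1ℤ               ≡⟨ eval-lhs p c 1ℤ ⟩
    ∏ (map (λ i → c + + i * 0ℤ) L)  ≡⟨ cong ∏ (ListP.map-cong drop-i L) ⟩
    ∏ (map (λ _ → c) L)             ≡⟨ trans (∏-map-const c L) (cong (c ^_) (length-oneTo (p ∸ 1))) ⟩
    c ^ suc m                       ≈⟨ x^[p-1]≈1 c≉0 ⟩
    1ℤ                              ∎
    where
    L = oneTo (p ∸ 1)
    drop-i : ∀ i → c + + i * 0ℤ ≡ c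
    drop-i i = trans (cong (λ z → c + z) (ℤP.*-zeroʳ (+ i))) (ℤP.+-identityʳ c)

  rhsNotDiv-at-1 : eval (rhsNotDiv p) 1ℤ ≈ 1ℤ
  rhsNotDiv-at-1 = begin
    eval (rhsNotDiv p) 1ℤ   ≡⟨ eval-rhsNotDiv p 1ℤ ⟩
    - ∑ (map (1ℤ ^_) L)     ≡⟨ cong (λ xs → - ∑ xs) (ListP.map-cong ℤP.^-zeroˡ L) ⟩
    - ∑ (map (λ _ → 1ℤ) L)  ≡⟨ cong -_ (trans (∑-map-const-1 L) (cong +_ (length-oneTo (p ∸ 1)))) ⟩
    - + suc m               ≈⟨ ≈-sym (congruent Signed.∣-refl) ⟩
    1ℤ                      ∎
    where
    L = oneTo (p ∸ 1)

  lhs≈0 : ∀ {c x} → c ≉ 0ℤ → x ≉ 1ℤ → eval (lhs p c) x ≈ 0ℤ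
  lhs≈0 {c} {x} c≉0 x≉1 = ≈-trans (≡⇒≈ (eval-lhs p c x)) (vanish (linear-root c≉0 (x≉1 ∘ -≈0⇒≈)))
    where
    vanish : ∃[ i ] (i ∈ oneTo (p ∸ 1) × c + + i * (x - 1ℤ) ≈ 0ℤ) →
             ∏ (map (λ i → c + + i * (x - 1ℤ)) (oneTo (p ∸ 1))) ≈ 0ℤ
    vanish (i , i∈L , root) = ∏≈0 (λ i → c + + i * (x - 1ℤ)) (oneTo (p ∸ 1)) i∈L root

  rhsNotDiv≈0 : ∀ {x} → x ≉ 1ℤ → eval (rhsNotDiv p) x ≈ 0ℤ
  rhsNotDiv≈0 {x} x≉1 = ≈-trans (≡⇒≈ (eval-rhsNotDiv p x)) (-‿cong S≈0)
    where
    S = ∑ (map (x ^_) (oneTo (p ∸ 1)))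
    G = ∑ (applyUpTo (x ^_) (suc m))
    regroup : ∀ x g → (x - 1ℤ) * (x * g) ≡ x * ((x - 1ℤ) * g)
    regroup = solve-∀
    expand : ∀ x y → x * (y - 1ℤ) ≡ x * y - x
    expand = solve-∀
    S≡xG : S ≡ x * G
    S≡xG = trans (cong ∑ (ListP.map-applyUpTo suc (x ^_) (suc m))) (∑-powers-shift x (suc m))
    [x-1]S≈0 : (x - 1ℤ) * S ≈ 0ℤ
    [x-1]S≈0 = begin
      (x - 1ℤ) * S             ≡⟨ cong ((x - 1ℤ) *_) S≡xG ⟩
      (x - 1ℤ) * (x * G)       ≡⟨ regroup x G ⟩
      x * ((x - 1ℤ) * G)       ≡⟨ cong (x *_) (geometric-sum x (suc m)) ⟩
      x * (x ^ suc m - 1ℤ)     ≡⟨ expand x (x ^ suc m) ⟩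
      x ^ p - x                ≈⟨ ≈⇒-≈0 (x^p≈x x) ⟩
      0ℤ                       ∎
    S≈0 : S ≈ 0ℤ
    S≈0 = [ flip contradiction x≉1 ∘ -≈0⇒≈ , id ]′ (x*y≈0⇒x≈0∨y≈0 (x - 1ℤ) S [x-1]S≈0)

  lhs≈rhsNotDiv-at-x≉1 : ∀ {c x} → c ≉ 0ℤ → x ≉ 1ℤ → eval (lhs p c) x ≈ eval (rhsNotDiv p) x
  lhs≈rhsNotDiv-at-x≉1 c≉0 x≉1 = ≈-trans (lhs≈0 c≉0 x≉1) (≈-sym (rhsNotDiv≈0 x≉1))

  lhs≈rhsNotDiv : ∀ {c} → c ≉ 0ℤ → ∀ {k} → k < p →
                  eval (lhs p c) (+ k) ≈ eval (rhsNotDiv p) (+ k)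
  lhs≈rhsNotDiv c≉0 {1}           _   = ≈-trans (lhs-at-1 c≉0) (≈-sym rhsNotDiv-at-1)
  lhs≈rhsNotDiv c≉0 {0}           _   =
    lhs≈rhsNotDiv-at-x≉1 c≉0 (i<j<p⇒j≉i (s≤s z≤n) (s≤s (s≤s z≤n)) ∘ ≈-sym)
  lhs≈rhsNotDiv c≉0 {suc (suc k)} k<p =
    lhs≈rhsNotDiv-at-x≉1 c≉0 (i<j<p⇒j≉i (s≤s (s≤s z≤n)) k<p)

  agree⇒≡P : ∀ f g → length f ≤ p → length g ≤ p →
             (∀ {k} → k < p → eval f (+ k) ≈ eval g (+ k)) → f ≡P g [mod + p ]
  agree⇒≡P f g f≤p g≤p agree k = Signed.∣⇒∣ᵤ (n∣a-b (-≈0⇒≈ {coeff f k} {coeff g k} coeff-D≈0))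
    where
    D = f +P negP g
    D≤p : length D ≤ p
    D≤p = length-+P f (negP g) f≤p (subst (_≤ p) (sym (length-·P -1ℤ g)) g≤p)
    roots : Roots D +_ p
    roots {i} i<p = ≈-trans (≡⇒≈ eval-D) (≈⇒-≈0 (agree i<p))
      where
      eval-D : eval D (+ i) ≡ eval f (+ i) - eval g (+ i)
      eval-D = trans (eval-+P f (negP g) (+ i)) (cong (λ z → eval f (+ i) + z) (eval-negP g (+ i)))
    coeff-D : coeff D k ≡ coeff f k - coeff g k
    coeff-D = trans (coeff-+P f (negP g) k) (cong (λ z → coeff f k + z) (coeff-negP g k))
    coeff-D≈0 : coeff f k - coeff g k ≈ 0ℤ
    coeff-D≈0 = ≈-trans (≡⇒≈ (sym coeff-D)) (roots⇒coeff≈0 p D +_ D≤p i<j<p⇒j≉i roots k)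

  p∣c⇒lhs≡rhsDiv : ∀ c → + p ∣ c → lhs p c ≡P rhsDiv p [mod + p ]
  p∣c⇒lhs≡rhsDiv c p∣c = agree⇒≡P (lhs p c) (rhsDiv p) (length-lhs p c) (length-rhsDiv p)
    (λ {k} _ → lhs≈rhsDiv (∣⇒≈0 {c} (Signed.∣ᵤ⇒∣ p∣c)) (+ k))

  p∤c⇒lhs≡rhsNotDiv : ∀ c → ¬ (+ p ∣ c) → lhs p c ≡P rhsNotDiv p [mod + p ]
  p∤c⇒lhs≡rhsNotDiv c p∤c = agree⇒≡P (lhs p c) (rhsNotDiv p) (length-lhs p c) (length-rhsNotDiv p)
    (lhs≈rhsNotDiv (p∤c ∘ Signed.∣⇒∣ᵤ ∘ ≈0⇒∣ {c}))

mainTheorem9 : (p : ℕ) → Prime p → (c : ℤ) →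
    ((+ p) ∣ c → lhs p c ≡P rhsDiv p [mod + p ]) ×
    (¬ ((+ p) ∣ c) → lhs p c ≡P rhsNotDiv p [mod + p ])
mainTheorem9 p p-prime c with ℕ.nonTrivial⇒n>1 p ⦃ prime⇒nonTrivial p-prime ⦄
mainTheorem9 (suc (suc m)) p-prime c | s≤s (s≤s z≤n) = p∣c⇒lhs≡rhsDiv c , p∤c⇒lhs≡rhsNotDiv c
  where open ModuloPrime m p-prime
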